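{- There is a constant $C$ such that every 2-program $P$ with $n$ atoms has at most $C\times 3^{n/3}$ stable models.
   Context: A clause is $p\leftarrow B$ or $\leftarrow B$ (a constraint), where $p$ is an atom and $B$ is a finite set of literals (atoms $a$ or negated atoms $\mathrm{not}(a)$). A propositional logic program is a finite set of clauses; it is a 2-program if every clause has at most 2 literals, counting the head. $M\subseteq\mathit{At}(P)$ (the set of atoms of $P$) is a stable model of $P$ if $M$ satisfies all constraints of $P$ and is the least model of the Gelfond–Lifschitz reduct $P^M$, obtained by deleting every non-constraint clause with some $\mathrm{not}(a)$, $a\in M$, in its body and deleting negated literals from the remaining non-constraint clauses. -}

module Defs where

open import Data.Nat using (ℕ; zero; suc; _+_; _≤_)
open import Data.Bool using (Bool; true; false; _∨_)
open import Data.Fin using (Fin)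
open import Data.Fin.Subset using (Subset; _∈_; _∉_; _⊆_)
open import Data.Vec using (lookup)
open import Data.Maybe using (Maybe; just; nothing)
open import Data.List using (List; []; _∷_; length)
open import Data.List.Relation.Unary.All using (All)
open import Data.List.Relation.Unary.Any using (Any)
open import Data.Product using (_×_; _,_; Σ)
open import Relation.Nullary using (¬_)
open import Relation.Binary.PropositionalEquality using (_≡_)

data Lit (n : ℕ) : Set where
  pos : Fin n → Lit n
  neg : Fin n → Lit n

-- A clause  p ← B  (head = just p)  or a constraint  ← B  (head = nothing).
-- The finite body set B is represented by a list of literals.
record Clause (n : ℕ) : Set where
  constructor _⇐_
  field
    head : Maybe (Fin n)
    body : List (Lit n)
open Clause public

Program : ℕ → Set
Program n = List (Clause n)

clauseSize : ∀ {n} → Clause n → ℕ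
clauseSize (just _  ⇐ B) = suc (length B)
clauseSize (nothing ⇐ B) = length B

Is2Program : ∀ {n} → Program n → Set
Is2Program P = All (λ c → clauseSize c ≤ 2) P

litAtom : ∀ {n} → Lit n → Fin n
litAtom (pos a) = a
litAtom (neg a) = a

OccursInClause : ∀ {n} → Fin n → Clause n → Set
OccursInClause a c = (head c ≡ just a) Data.Sum.⊎ Any (λ l → litAtom l ≡ a) (body c)
  where import Data.Sum

-- At(P) = Fin n, i.e. every atom of Fin n occurs in P
HasAtoms : ∀ {n} → Program n → Set
HasAtoms {n} P = (a : Fin n) → Any (OccursInClause a) P

SatLit : ∀ {n} → Subset n → Lit n → Set
SatLit M (pos a) = a ∈ M
SatLit M (neg a) = a ∉ M

SatConstraint : ∀ {n} → Subset n → List (Lit n) → Set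
SatConstraint M B = ¬ All (SatLit M) B

SatConstraints : ∀ {n} → Subset n → Program n → Set
SatConstraints M [] = Data.Unit.⊤ where import Data.Unit
SatConstraints M ((just _  ⇐ B) ∷ P) = SatConstraints M P
SatConstraints M ((nothing ⇐ B) ∷ P) = SatConstraint M B × SatConstraints M P

-- definite (Horn) programs: rules  h ← b₁,…,bₖ
DefRule : ℕ → Set
DefRule n = Fin n × List (Fin n)

blocked : ∀ {n} → Subset n → List (Lit n) → Bool
blocked M [] = false
blocked M (pos a ∷ B) = blocked M B
blocked M (neg a ∷ B) = lookup M a ∨ blocked M B

positives : ∀ {n} → List (Lit n) → List (Fin n)
positives [] = []
positives (pos a ∷ B) = a ∷ positives B
positives (neg a ∷ B) = positives B

reduct : ∀ {n} → Subset n → Program n → List (DefRule n)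
reduct M [] = []
reduct M ((nothing ⇐ B) ∷ P) = reduct M P
reduct M ((just h ⇐ B) ∷ P) with blocked M B
... | true  = reduct M P
... | false = (h , positives B) ∷ reduct M P

IsModel : ∀ {n} → List (DefRule n) → Subset n → Set
IsModel Q M = All (λ r → All (_∈ M) (Data.Product.proj₂ r) → Data.Product.proj₁ r ∈ M) Q
  where import Data.Product

IsLeastModel : ∀ {n} → List (DefRule n) → Subset n → Set
IsLeastModel {n} Q M = IsModel Q M × ((M′ : Subset n) → IsModel Q M′ → M ⊆ M′)

IsStable : ∀ {n} → Program n → Subset n → Set
IsStable P M = SatConstraints M P × IsLeastModel (reduct M P) M

{-# OPTIONS --safe #-}
module Submission where

-- Let M be a stable model of a 2-program P. Join two atoms a and b when b follows from P once a
-- alone is assumed false (or vice versa). The complement of M is then a maximal independent set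
-- of this graph, restricted to the atoms not derivable from the negation-free clauses of P.
-- Independence holds because M is a model of every reduct P^R with M ⊆ R. Maximality holds
-- because M is the least model of P^M: when every body has at most one literal, each atom of M
-- is derived either from the negation-free clauses or from a single false atom.
--
-- Distinct stable models thus give distinct maximal independent sets. By Moon and Moser, a graph
-- on m vertices has at most 3^(m/3) of them. To see this, pick a vertex v whose closed
-- neighbourhood N[v] has the least size d. Every maximal independent set contains some u ∈ N[v],
-- and removing u leaves a maximal independent set of the graph minus N[u], which has at most
-- m - d vertices. So the count is at most d · 3^((m-d)/3) ≤ 3^(m/3), because d³ ≤ 3^d. Everything
-- is cubed to stay in ℕ.

open import Defs
open import Data.Nat using (ℕ; zero; suc; _+_; _*_; _^_; _≤_; z≤n; s≤s)
open import Data.Nat.Properties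
open import Data.Nat.ListAction using (sum)
open import Data.Nat.Tactic.RingSolver using (solve-∀)
open import Data.Bool using (true; false)
open import Data.Bool.Properties using (∨-identityʳ; ¬-not)
open import Data.Fin using (Fin; zero; suc) renaming (_≟_ to _≟ᶠ_)
open import Data.Fin.Properties using (any?)
open import Data.Fin.Subset
open import Data.Fin.Subset.Properties
open import Data.Fin.Subset.Induction using (⊂-wellFounded)
open import Data.Maybe using (just; nothing)
open import Data.Vec using ([]; _∷_; here; there; lookup)
open import Data.Vec.Properties using ([]=⇒lookup; lookup⇒[]=)
open import Data.List using (List; []; _∷_; length; map; filter)
open import Data.List.Properties using (length-map; filter-accept)
open import Data.List.Extrema.Nat using (argmin; argmin-all; f[argmin]≤f[xs]; max; argmax-all; xs≤max)
open import Data.List.Membership.Propositional using (lose) renaming (_∈_ to _∈ₗ_)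
open import Data.List.Membership.Propositional.Properties using (∈-map⁺)
open import Data.List.Relation.Unary.All as All using (All; []; _∷_)
import Data.List.Relation.Unary.All.Properties as All
open import Data.List.Relation.Unary.Any using (Any; here; there)
open import Data.List.Relation.Unary.AllPairs using ([]; _∷_)
open import Data.List.Relation.Unary.Unique.Propositional using (Unique)
import Data.List.Relation.Unary.Unique.Propositional.Properties as Unique
open import Data.Product using (Σ; ∃; _×_; _,_; proj₁; proj₂; map₂)
open import Data.Sum using (_⊎_; inj₁; inj₂)
open import Function using (_∘_)
open import Induction.WellFounded as WF using (WfRec)
open import Relation.Nullary using (Dec; does; yes; no; contradiction)
open import Relation.Nullary.Decidable using (_×-dec_; _⊎-dec_; _→-dec_; ¬?; decidable-stable)
open import Relation.Unary using (Decidable)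
open import Relation.Binary.PropositionalEquality

private
  variable
    n : ℕ
    A B : Set
    a c h x : Fin n
    p q R R′ X M : Subset n

n^3≤3^n : ∀ n → n ^ 3 ≤ 3 ^ n
n^3≤3^n 0 = z≤n
n^3≤3^n 1 = m≤m+n 1 2
n^3≤3^n 2 = m≤m+n 8 1
n^3≤3^n 3 = ≤-refl
n^3≤3^n (suc m@(suc (suc (suc k)))) = begin
  (4 + k) ^ 3                                            ≤⟨ m≤m+n _ _ ⟩
  (4 + k) ^ 3 + (2 * k ^ 3 + 15 * k ^ 2 + 33 * k + 17)   ≡⟨ cube-step k ⟩
  3 * (3 + k) ^ 3                                        ≤⟨ *-monoʳ-≤ 3 (n^3≤3^n m) ⟩
  3 * 3 ^ m                                              ∎
  where
  open ≤-Reasoning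
  -- The ring solver does not handle _^_, so cubes are written out as _^_ unfolds them.
  cube-step : ∀ j → (4 + j) * ((4 + j) * ((4 + j) * 1))
                    + (2 * (j * (j * (j * 1))) + 15 * (j * (j * 1)) + 33 * j + 17)
                  ≡ 3 * ((3 + j) * ((3 + j) * ((3 + j) * 1)))
  cube-step = solve-∀

sum≤length*bound : ∀ {b} (cs : List ℕ) → All (_≤ b) cs → sum cs ≤ length cs * b
sum≤length*bound []       []           = z≤n
sum≤length*bound (c ∷ cs) (c≤b ∷ cs≤b) = +-mono-≤ c≤b (sum≤length*bound cs cs≤b)

sum^3≤length^3*bound : ∀ {b} (cs : List ℕ) → All (λ c → c ^ 3 ≤ b) cs → sum cs ^ 3 ≤ length cs ^ 3 * b
sum^3≤length^3*bound {b} cs cs^3≤b = begin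
  sum cs ^ 3                    ≤⟨ ^-monoˡ-≤ 3 (sum≤length*bound cs (xs≤max 0 cs)) ⟩
  (length cs * max 0 cs) ^ 3    ≡⟨ cube-* (length cs) (max 0 cs) ⟩
  length cs ^ 3 * max 0 cs ^ 3  ≤⟨ *-monoʳ-≤ (length cs ^ 3) (argmax-all (λ c → c) z≤n cs^3≤b) ⟩
  length cs ^ 3 * b             ∎
  where
  open ≤-Reasoning
  cube-* : ∀ i j → (i * j) * ((i * j) * ((i * j) * 1)) ≡ (i * (i * (i * 1))) * (j * (j * (j * 1)))
  cube-* = solve-∀

sum-mono : ∀ {f g : A → ℕ} (xs : List A) → (∀ x → f x ≤ g x) → sum (map f xs) ≤ sum (map g xs)
sum-mono []       f≤g = z≤n
sum-mono (x ∷ xs) f≤g = +-mono-≤ (f≤g x) (sum-mono xs f≤g)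

module _ {Covers : A → B → Set} (covers? : ∀ a → Decidable (Covers a)) where

  #covered : List B → A → ℕ
  #covered ys a = length (filter (covers? a) ys)

  #covered-∷-≤ : ∀ y ys a → #covered ys a ≤ #covered (y ∷ ys) a
  #covered-∷-≤ y ys a with covers? a y
  ... | yes _ = n≤1+n _
  ... | no  _ = ≤-refl

  sum-#covered-∷ : ∀ {y as} ys → Any (λ a → Covers a y) as →
                   suc (sum (map (#covered ys) as)) ≤ sum (map (#covered (y ∷ ys)) as)
  sum-#covered-∷ {y} {a ∷ as} ys (here a-covers-y) =
    +-mono-≤ (≤-reflexive (cong length (sym (filter-accept (covers? a) a-covers-y))))
             (sum-mono as (#covered-∷-≤ y ys))
  sum-#covered-∷ {y} {a ∷ as} ys (there covered) = begin
    suc (#covered ys a + sum (map (#covered ys) as))        ≡⟨ +-suc _ _ ⟨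
    #covered ys a + suc (sum (map (#covered ys) as))        ≤⟨ +-mono-≤ (#covered-∷-≤ y ys a)
                                                                        (sum-#covered-∷ ys covered) ⟩
    #covered (y ∷ ys) a + sum (map (#covered (y ∷ ys)) as)  ∎
    where open ≤-Reasoning

  union-bound : ∀ as {ys} → All (λ y → Any (λ a → Covers a y) as) ys → length ys ≤ sum (map (#covered ys) as)
  union-bound as []                   = z≤n
  union-bound as (covered ∷ covered′) = ≤-trans (s≤s (union-bound as covered′)) (sum-#covered-∷ _ covered)

length≤1 : ∀ {z : A} {xs} → Unique xs → All (_≡ z) xs → length xs ≤ 1
length≤1 []              []                = z≤n
length≤1 (_ ∷ [])        (_ ∷ [])          = ≤-refl
length≤1 ((x≢y ∷ _) ∷ _) (refl ∷ refl ∷ _) = contradiction refl x≢y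

map⁺-injectiveOn : ∀ {P : A → Set} {f : A → B} → (∀ {x y} → P x → P y → f x ≡ f y → x ≡ y) →
                   ∀ {xs} → All P xs → Unique xs → Unique (map f xs)
map⁺-injectiveOn inj []         []           = []
map⁺-injectiveOn inj (px ∷ pxs) (x∉xs ∷ xs!) =
  All.map⁺ (All.zipWith (λ (py , x≢y) → x≢y ∘ inj px py) (pxs , x∉xs)) ∷ map⁺-injectiveOn inj pxs xs!

elements : Subset n → List (Fin n)
elements []            = []
elements (inside  ∷ p) = zero ∷ map suc (elements p)
elements (outside ∷ p) = map suc (elements p)

elements-sound : ∀ (p : Subset n) → All (_∈ p) (elements p)
elements-sound []            = []
elements-sound (inside  ∷ p) = here ∷ All.map⁺ (All.map there (elements-sound p))
elements-sound (outside ∷ p) = All.map⁺ (All.map there (elements-sound p))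

elements-complete : x ∈ p → x ∈ₗ elements p
elements-complete {p = inside  ∷ p} here       = here refl
elements-complete {p = inside  ∷ p} (there x∈) = there (∈-map⁺ suc (elements-complete x∈))
elements-complete {p = outside ∷ p} (there x∈) = ∈-map⁺ suc (elements-complete x∈)

length-elements : ∀ (p : Subset n) → length (elements p) ≡ ∣ p ∣
length-elements []            = refl
length-elements (inside  ∷ p) = cong suc (trans (length-map suc (elements p)) (length-elements p))
length-elements (outside ∷ p) = trans (length-map suc (elements p)) (length-elements p)

∃-argmin : ∀ (f : Fin n → ℕ) → Nonempty p → ∃ λ v → v ∈ p × (∀ {u} → u ∈ p → f v ≤ f u)
∃-argmin {p = p} f (v₀ , v₀∈p) =
  argmin f v₀ (elements p) ,
  argmin-all f v₀∈p (elements-sound p) ,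
  All.lookup (f[argmin]≤f[xs] v₀ (elements p)) ∘ elements-complete

subsetOf : ∀ {n} {P : Fin n → Set} → Decidable P → Subset n
subsetOf {zero}  P? = []
subsetOf {suc n} P? = does (P? zero) ∷ subsetOf (P? ∘ suc)

∈-subsetOf⁺ : ∀ {n} {P : Fin n → Set} (P? : Decidable P) {x} → P x → x ∈ subsetOf P?
∈-subsetOf⁺ P? {zero} px with P? zero
... | yes _  = here
... | no ¬px = contradiction px ¬px
∈-subsetOf⁺ P? {suc x} px = there (∈-subsetOf⁺ (P? ∘ suc) px)

∈-subsetOf⁻ : ∀ {n} {P : Fin n → Set} (P? : Decidable P) {x} → x ∈ subsetOf P? → P x
∈-subsetOf⁻ P? {zero} x∈ with P? zero
∈-subsetOf⁻ P? {zero} here | yes px = px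
∈-subsetOf⁻ P? {suc x} (there x∈) = ∈-subsetOf⁻ (P? ∘ suc) x∈

x∈p─q⇒x∉q : x ∈ p ─ q → x ∉ q
x∈p─q⇒x∉q {x = zero}  {p = inside  ∷ _} {outside ∷ _} here       = λ ()
x∈p─q⇒x∉q {x = zero}  {p = outside ∷ _} {outside ∷ _} ()
x∈p─q⇒x∉q {x = suc _} {p = _       ∷ _} {_       ∷ _} (there x∈) = x∈p─q⇒x∉q x∈ ∘ drop-there

∣p∩q∣+∣p─q∣≡∣p∣ : ∀ (p q : Subset n) → ∣ p ∩ q ∣ + ∣ p ─ q ∣ ≡ ∣ p ∣
∣p∩q∣+∣p─q∣≡∣p∣ []            []            = refl
∣p∩q∣+∣p─q∣≡∣p∣ (inside  ∷ p) (inside  ∷ q) = cong suc (∣p∩q∣+∣p─q∣≡∣p∣ p q)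
∣p∩q∣+∣p─q∣≡∣p∣ (inside  ∷ p) (outside ∷ q) = trans (+-suc _ _) (cong suc (∣p∩q∣+∣p─q∣≡∣p∣ p q))
∣p∩q∣+∣p─q∣≡∣p∣ (outside ∷ p) (inside  ∷ q) = ∣p∩q∣+∣p─q∣≡∣p∣ p q
∣p∩q∣+∣p─q∣≡∣p∣ (outside ∷ p) (outside ∷ q) = ∣p∩q∣+∣p─q∣≡∣p∣ p q

∣p─q∣≤∣p─r∣ : ∀ (p q r : Subset n) → ∣ p ∩ r ∣ ≤ ∣ p ∩ q ∣ → ∣ p ─ q ∣ ≤ ∣ p ─ r ∣
∣p─q∣≤∣p─r∣ p q r ∣p∩r∣≤∣p∩q∣ = +-cancelˡ-≤ ∣ p ∩ r ∣ _ _ (begin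
  ∣ p ∩ r ∣ + ∣ p ─ q ∣  ≤⟨ +-monoˡ-≤ ∣ p ─ q ∣ ∣p∩r∣≤∣p∩q∣ ⟩
  ∣ p ∩ q ∣ + ∣ p ─ q ∣  ≡⟨ ∣p∩q∣+∣p─q∣≡∣p∣ p q ⟩
  ∣ p ∣                  ≡⟨ ∣p∩q∣+∣p─q∣≡∣p∣ p r ⟨
  ∣ p ∩ r ∣ + ∣ p ─ r ∣  ∎)
  where open ≤-Reasoning

-‿injectiveOn : x ∈ p → x ∈ q → p - x ≡ q - x → p ≡ q
-‿injectiveOn {x = x} x∈p x∈q p-x≡q-x =
  ⊆-antisym (⊆-by-reinsertion x∈q p-x≡q-x) (⊆-by-reinsertion x∈p (sym p-x≡q-x))
  where
  ⊆-by-reinsertion : ∀ {p q} → x ∈ q → p - x ≡ q - x → p ⊆ q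
  ⊆-by-reinsertion {p} {q} x∈q p-x≡q-x {y} y∈p with y ≟ᶠ x
  ... | yes refl = x∈q
  ... | no  y≢x  = p─q⊆p q ⁅ x ⁆ (subst (y ∈_) p-x≡q-x (x∈p∧x≢y⇒x∈p-y y∈p y≢x))

∁-injective : ∁ p ≡ ∁ q → p ≡ q
∁-injective ∁p≡∁q = ⊆-antisym (∁p⊆∁q⇒p⊇q (⊆-reflexive (sym ∁p≡∁q))) (∁p⊆∁q⇒p⊇q (⊆-reflexive ∁p≡∁q))

x∉p⇒p⊆∁⁅x⁆ : x ∉ p → p ⊆ ∁ ⁅ x ⁆
x∉p⇒p⊆∁⁅x⁆ {p = p} x∉p y∈p = x∉p⇒x∈∁p λ y∈⁅x⁆ → x∉p (subst (_∈ p) (x∈⁅y⁆⇒x≡y _ y∈⁅x⁆) y∈p)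

lookup≡false⇒∉ : lookup p x ≡ false → x ∉ p
lookup≡false⇒∉ px≡false x∈p = contradiction (trans (sym ([]=⇒lookup x∈p)) px≡false) λ ()

module MoonMoser {n : ℕ} (N[_] : Fin n → Subset n)
                 (x∈N[x] : ∀ x → x ∈ N[ x ]) (N[]-sym : ∀ {x y} → y ∈ N[ x ] → x ∈ N[ y ]) where

  record IsMaximalIndependent (S W : Subset n) : Set where
    field
      included    : W ⊆ S
      independent : ∀ {a b} → a ∈ W → b ∈ W → b ∈ N[ a ] → a ≡ b
      dominating  : ∀ {a} → a ∈ S → ∃ λ b → b ∈ W × a ∈ N[ b ]

  open IsMaximalIndependent

  MoonMoserBound : Subset n → Set
  MoonMoserBound S = ∀ {Ws} → Unique Ws → All (IsMaximalIndependent S) Ws → length Ws ^ 3 ≤ 3 ^ ∣ S ∣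

  private
    variable
      S W : Subset n
      u : Fin n

  meets-N[] : ∀ {v} → v ∈ S → IsMaximalIndependent S W → Any (_∈ W) (elements (S ∩ N[ v ]))
  meets-N[] v∈S mis =
    let (b , b∈W , v∈N[b]) = dominating mis v∈S
    in lose (elements-complete (x∈p∩q⁺ (included mis b∈W , N[]-sym v∈N[b]))) b∈W

  remove-isMaximalIndependent : IsMaximalIndependent S W → u ∈ W →
                                IsMaximalIndependent (S ─ N[ u ]) (W - u)
  remove-isMaximalIndependent {S} {W} {u} mis u∈W = record
    { included    = λ x∈W-u →
        let x∈W = p─q⊆p W ⁅ u ⁆ x∈W-u
            x≢u = x∉⁅y⁆⇒x≢y (x∈p─q⇒x∉q x∈W-u)
        in x∈p∧x∉q⇒x∈p─q (included mis x∈W) (x≢u ∘ sym ∘ independent mis u∈W x∈W)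
    ; independent = λ a∈W-u b∈W-u → independent mis (p─q⊆p W ⁅ u ⁆ a∈W-u) (p─q⊆p W ⁅ u ⁆ b∈W-u)
    ; dominating  = λ {a} a∈S─N[u] →
        let (b , b∈W , a∈N[b]) = dominating mis (p─q⊆p S N[ u ] a∈S─N[u])
            b≢u b≡u = x∈p─q⇒x∉q a∈S─N[u] (subst (λ b → a ∈ N[ b ]) b≡u a∈N[b])
        in b , x∈p∧x≢y⇒x∈p-y b∈W b≢u , a∈N[b]
    }

  empty-bound : Empty S → MoonMoserBound S
  empty-bound {S} S-empty {Ws} uniq mis = begin
    length Ws ^ 3  ≤⟨ ^-monoˡ-≤ 3 (length≤1 uniq (All.map empty mis)) ⟩
    1              ≤⟨ m^n>0 3 ∣ S ∣ ⟩
    3 ^ ∣ S ∣      ∎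
    where
    open ≤-Reasoning
    empty : IsMaximalIndependent S W → W ≡ ⊥
    empty mis = Empty-unique (S-empty ∘ map₂ (included mis))

  containing-bound : (∀ {S′} → S′ ⊂ S → MoonMoserBound S′) →
                     ∀ {Ws} → Unique Ws → All (IsMaximalIndependent S) Ws →
                     u ∈ S → length (filter (u ∈?_) Ws) ^ 3 ≤ 3 ^ ∣ S ─ N[ u ] ∣
  containing-bound {S} {u} ih {Ws} uniq mis u∈S =
    subst (λ k → k ^ 3 ≤ 3 ^ ∣ S ─ N[ u ] ∣) (length-map (_- u) Ws∋u)
      (ih (p∩q≢∅⇒p─q⊂p S N[ u ] (u , x∈p∩q⁺ (u∈S , x∈N[x] u)))
          (map⁺-injectiveOn (λ (_ , u∈W₁) (_ , u∈W₂) → -‿injectiveOn u∈W₁ u∈W₂) mis∋u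
                            (Unique.filter⁺ (u ∈?_) uniq))
          (All.map⁺ (All.map (λ (misW , u∈W) → remove-isMaximalIndependent misW u∈W) mis∋u)))
    where
    Ws∋u = filter (u ∈?_) Ws
    mis∋u : All (λ W → IsMaximalIndependent S W × u ∈ W) Ws∋u
    mis∋u = All.zip (All.filter⁺ (u ∈?_) mis , All.all-filter (u ∈?_) Ws)

  branch-bound : Nonempty S → (∀ {S′} → S′ ⊂ S → MoonMoserBound S′) → MoonMoserBound S
  branch-bound {S} S-nonempty ih {Ws} uniq mis = begin
    length Ws ^ 3                        ≤⟨ ^-monoˡ-≤ 3 (union-bound _∈?_ us (All.map (meets-N[] v∈S) mis)) ⟩
    sum (map #containing us) ^ 3         ≤⟨ sum^3≤length^3*bound (map #containing us)
                                              (All.map⁺ (All.map #containing-bound (elements-sound _))) ⟩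
    length (map #containing us) ^ 3 * 3 ^ r  ≡⟨ cong (λ k → k ^ 3 * 3 ^ r) (length-map #containing us) ⟩
    length us ^ 3 * 3 ^ r                ≡⟨ cong (λ k → k ^ 3 * 3 ^ r) (length-elements (S ∩ N[ v ])) ⟩
    d ^ 3 * 3 ^ r                        ≤⟨ *-monoˡ-≤ (3 ^ r) (n^3≤3^n d) ⟩
    3 ^ d * 3 ^ r                        ≡⟨ ^-distribˡ-+-* 3 d r ⟨
    3 ^ (d + r)                          ≡⟨ cong (3 ^_) (∣p∩q∣+∣p─q∣≡∣p∣ S N[ v ]) ⟩
    3 ^ ∣ S ∣                            ∎
    where
    open ≤-Reasoning
    min-degree = ∃-argmin (λ u → ∣ S ∩ N[ u ] ∣) S-nonempty
    v = proj₁ min-degree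
    v∈S = proj₁ (proj₂ min-degree)
    d = ∣ S ∩ N[ v ] ∣
    r = ∣ S ─ N[ v ] ∣
    us = elements (S ∩ N[ v ])
    #containing = #covered _∈?_ Ws
    #containing-bound : u ∈ S ∩ N[ v ] → #containing u ^ 3 ≤ 3 ^ r
    #containing-bound {u} u∈S∩N[v] =
      let u∈S = proj₁ (x∈p∩q⁻ S N[ v ] u∈S∩N[v]) in
      ≤-trans (containing-bound ih uniq mis u∈S)
              (^-monoʳ-≤ 3 (∣p─q∣≤∣p─r∣ S N[ u ] N[ v ] (proj₂ (proj₂ min-degree) u∈S)))

  moon-moser : ∀ S → MoonMoserBound S
  moon-moser = WF.All.wfRec ⊂-wellFounded _ MoonMoserBound bound
    where
    bound : ∀ S → WfRec _⊂_ MoonMoserBound S → MoonMoserBound S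
    bound S ih with nonempty? S
    ... | yes S-nonempty = branch-bound S-nonempty ih
    ... | no  S-empty    = empty-bound S-empty

ClosedUnder : Program n → Subset n → Subset n → Set
ClosedUnder P R X = ∀ {h B} → (just h ⇐ B) ∈ₗ P → blocked R B ≡ false → All (_∈ X) (positives B) → h ∈ X

reduct-model⇒closed : ∀ P → IsModel (reduct R P) X → ClosedUnder P R X
reduct-model⇒closed ((nothing ⇐ _) ∷ P) model (there cl) = reduct-model⇒closed P model cl
reduct-model⇒closed {R = R} ((just _ ⇐ B) ∷ P) model cl with blocked R B in blocked≡
reduct-model⇒closed _ model       (here refl) | true  = λ unblocked →
  contradiction (trans (sym blocked≡) unblocked) λ ()
reduct-model⇒closed _ (holds ∷ _) (here refl) | false = λ _ → holds
reduct-model⇒closed (_ ∷ P) model       (there cl) | true  = reduct-model⇒closed P model cl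
reduct-model⇒closed (_ ∷ P) (_ ∷ model) (there cl) | false = reduct-model⇒closed P model cl

closed⇒reduct-model : ∀ P → ClosedUnder P R X → IsModel (reduct R P) X
closed⇒reduct-model []                  closed = []
closed⇒reduct-model ((nothing ⇐ _) ∷ P) closed = closed⇒reduct-model P (closed ∘ there)
closed⇒reduct-model {R = R} ((just _ ⇐ B) ∷ P) closed with blocked R B in blocked≡
... | true  = closed⇒reduct-model P (closed ∘ there)
... | false = closed (here refl) blocked≡ ∷ closed⇒reduct-model P (closed ∘ there)

blocked-antitone : R ⊆ R′ → ∀ B → blocked R′ B ≡ false → blocked R B ≡ false
blocked-antitone R⊆R′ []          _         = refl
blocked-antitone R⊆R′ (pos _ ∷ B) unblocked = blocked-antitone R⊆R′ B unblocked
blocked-antitone {R = R} {R′} R⊆R′ (neg a ∷ B) unblocked with lookup R′ a in R′a | lookup R a in Ra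
... | false | false = blocked-antitone R⊆R′ B unblocked
... | false | true  = contradiction (R⊆R′ (lookup⇒[]= a R Ra)) (lookup≡false⇒∉ R′a)

reduct-model-antitone : ∀ P → R ⊆ R′ → IsModel (reduct R P) X → IsModel (reduct R′ P) X
reduct-model-antitone P R⊆R′ model =
  closed⇒reduct-model P (λ {_} {B} cl → reduct-model⇒closed P model cl ∘ blocked-antitone R⊆R′ B)

unblocked-neg⁺ : c ∉ R → blocked R (neg c ∷ []) ≡ false
unblocked-neg⁺ {c = c} {R} c∉R = trans (∨-identityʳ _) (¬-not (c∉R ∘ lookup⇒[]= c R))

unblocked-neg⁻ : blocked R (neg c ∷ []) ≡ false → c ∉ R
unblocked-neg⁻ {R = R} {c} unblocked = lookup≡false⇒∉ (trans (sym (∨-identityʳ (lookup R c))) unblocked)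

Entails : List (DefRule n) → Fin n → Set
Entails Q a = ∀ X → IsModel Q X → a ∈ X

isModel? : ∀ (Q : List (DefRule n)) X → Dec (IsModel Q X)
isModel? Q X = All.all? (λ (h , B) → All.all? (_∈? X) B →-dec h ∈? X) Q

allSubset? : ∀ {P : Subset n → Set} → (∀ X → Dec (P X)) → Dec (∀ X → P X)
allSubset? P? with anySubset? (¬? ∘ P?)
... | yes (X , ¬PX) = no λ ∀P → ¬PX (∀P X)
... | no  ¬∃¬P      = yes λ X → decidable-stable (P? X) (¬∃¬P ∘ (X ,_))

entails? : ∀ (Q : List (DefRule n)) → Decidable (Entails Q)
entails? Q a = allSubset? λ X → isModel? Q X →-dec a ∈? X

entails-clause : ∀ P {B} → (just h ⇐ B) ∈ₗ P → blocked R B ≡ false →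
                 All (Entails (reduct R P)) (positives B) → Entails (reduct R P) h
entails-clause P cl unblocked entailed X model =
  reduct-model⇒closed P model cl unblocked (All.map (λ entails → entails X model) entailed)

stable-entails : ∀ (P : Program n) → IsStable P M → M ⊆ R → Entails (reduct R P) a → a ∈ M
stable-entails P (_ , model , _) M⊆R entailed = entailed _ (reduct-model-antitone P M⊆R model)

module StableModelGraph (P : Program n) where

  -- ⊤ blocks every negative literal, so reduct ⊤ P is the negation-free part of P.
  Core : Subset n
  Core = subsetOf (entails? (reduct ⊤ P))

  -- reduct (∁ ⁅ a ⁆) P keeps exactly the clauses with no negative literal other than not(a).
  Linked : Fin n → Fin n → Set
  Linked a b = a ≡ b ⊎ Entails (reduct (∁ ⁅ a ⁆) P) b ⊎ Entails (reduct (∁ ⁅ b ⁆) P) a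

  linked? : ∀ a → Decidable (Linked a)
  linked? a b = a ≟ᶠ b ⊎-dec entails? _ b ⊎-dec entails? _ a

  N[_] : Fin n → Subset n
  N[ a ] = subsetOf (linked? a)

  x∈N[x] : ∀ x → x ∈ N[ x ]
  x∈N[x] x = ∈-subsetOf⁺ (linked? x) (inj₁ refl)

  N[]-sym : ∀ {x y} → y ∈ N[ x ] → x ∈ N[ y ]
  N[]-sym {x} {y} y∈N[x] with ∈-subsetOf⁻ (linked? x) y∈N[x]
  ... | inj₁ x≡y        = ∈-subsetOf⁺ (linked? y) (inj₁ (sym x≡y))
  ... | inj₂ (inj₁ x↝y) = ∈-subsetOf⁺ (linked? y) (inj₂ (inj₂ x↝y))
  ... | inj₂ (inj₂ y↝x) = ∈-subsetOf⁺ (linked? y) (inj₂ (inj₁ y↝x))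

  open MoonMoser N[_] x∈N[x] N[]-sym public

  Derivable : Subset n → Fin n → Set
  Derivable M c = Entails (reduct ⊤ P) c ⊎ ∃ λ b → b ∉ M × Entails (reduct (∁ ⁅ b ⁆) P) c

  derivable? : ∀ M → Decidable (Derivable M)
  derivable? M c = entails? _ c ⊎-dec any? λ b → ¬? (b ∈? M) ×-dec entails? _ c

  derivable-closed : Is2Program P → ClosedUnder P M (subsetOf (derivable? M))
  derivable-closed two {B = []} cl _ [] =
    ∈-subsetOf⁺ (derivable? _) (inj₁ (entails-clause P cl refl []))
  derivable-closed two {B = pos c ∷ []} cl _ (c∈ ∷ []) with ∈-subsetOf⁻ (derivable? _) c∈
  ... | inj₁ ⊤↝c             = ∈-subsetOf⁺ (derivable? _) (inj₁ (entails-clause P cl refl (⊤↝c ∷ [])))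
  ... | inj₂ (b , b∉M , b↝c) =
    ∈-subsetOf⁺ (derivable? _) (inj₂ (b , b∉M , entails-clause P cl refl (b↝c ∷ [])))
  derivable-closed two {B = neg c ∷ []} cl unblocked [] =
    ∈-subsetOf⁺ (derivable? _)
      (inj₂ (c , unblocked-neg⁻ unblocked , entails-clause P cl (unblocked-neg⁺ (x∈p⇒x∉∁p (x∈⁅x⁆ c))) []))
  derivable-closed two {B = _ ∷ _ ∷ _} cl = contradiction (All.lookup two cl) λ { (s≤s (s≤s ())) }

  complement-isMaximalIndependent : Is2Program P → IsStable P M → IsMaximalIndependent (∁ Core) (∁ M)
  complement-isMaximalIndependent {M = M} two stable@(_ , _ , least) = record
    { included    = included
    ; independent = independent
    ; dominating  = dominating
    }
    where
    included : ∁ M ⊆ ∁ Core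
    included x∈∁M = x∉p⇒x∈∁p λ x∈Core →
      x∈∁p⇒x∉p x∈∁M (stable-entails P stable ⊆⊤ (∈-subsetOf⁻ (entails? _) x∈Core))

    independent : ∀ {a b} → a ∈ ∁ M → b ∈ ∁ M → b ∈ N[ a ] → a ≡ b
    independent {a} {b} a∈∁M b∈∁M b∈N[a] with ∈-subsetOf⁻ (linked? a) b∈N[a]
    ... | inj₁ a≡b        = a≡b
    ... | inj₂ (inj₁ a↝b) =
      contradiction (stable-entails P stable (x∉p⇒p⊆∁⁅x⁆ (x∈∁p⇒x∉p a∈∁M)) a↝b) (x∈∁p⇒x∉p b∈∁M)
    ... | inj₂ (inj₂ b↝a) =
      contradiction (stable-entails P stable (x∉p⇒p⊆∁⁅x⁆ (x∈∁p⇒x∉p b∈∁M)) b↝a) (x∈∁p⇒x∉p a∈∁M)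

    dominating : ∀ {a} → a ∈ ∁ Core → ∃ λ b → b ∈ ∁ M × a ∈ N[ b ]
    dominating {a} a∈∁Core with a ∈? M
    ... | no a∉M  = a , x∉p⇒x∈∁p a∉M , x∈N[x] a
    ... | yes a∈M with ∈-subsetOf⁻ (derivable? M) (least _ (closed⇒reduct-model P (derivable-closed two)) a∈M)
    ...   | inj₁ ⊤↝a             = contradiction (∈-subsetOf⁺ (entails? _) ⊤↝a) (x∈∁p⇒x∉p a∈∁Core)
    ...   | inj₂ (b , b∉M , b↝a) = b , x∉p⇒x∈∁p b∉M , ∈-subsetOf⁺ (linked? b) (inj₂ (inj₁ b↝a))

stable-models-bound : ∀ {P : Program n} → Is2Program P →
                      ∀ {Ms} → Unique Ms → All (IsStable P) Ms → length Ms ^ 3 ≤ 3 ^ n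
stable-models-bound {n} {P} two {Ms} uniq stable = begin
  length Ms ^ 3          ≡⟨ cong (_^ 3) (length-map ∁ Ms) ⟨
  length (map ∁ Ms) ^ 3  ≤⟨ moon-moser (∁ Core) (Unique.map⁺ ∁-injective uniq)
                              (All.map⁺ (All.map (complement-isMaximalIndependent two) stable)) ⟩
  3 ^ ∣ ∁ Core ∣         ≤⟨ ^-monoʳ-≤ 3 (∣p∣≤n (∁ Core)) ⟩
  3 ^ n                  ∎
  where
  open ≤-Reasoning
  open StableModelGraph P

theorem6 : Σ ℕ λ C → (n : ℕ) (P : Program n) → Is2Program P → HasAtoms P →
    (Ms : List (Subset n)) → Unique Ms → All (IsStable P) Ms →
    length Ms ^ 3 ≤ C ^ 3 * 3 ^ n
theorem6 = 1 , λ n P two _ Ms uniq stable →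
  subst (length Ms ^ 3 ≤_) (sym (*-identityˡ (3 ^ n))) (stable-models-bound two uniq stable)
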